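{- The class of line graphs of bipartite graphs is intersectionwise $\chi$-guarding.
   Context: All graphs are finite and simple; classes are taken closed under isomorphism and induced subgraphs. The line graph $L(G)$ of $G$ has vertex set $E(G)$, two edges adjacent iff they share an endpoint. The graph-intersection of classes $\mathcal{A},\mathcal{B}$ is the class of all graphs $(V(G)\cap V(H),E(G)\cap E(H))$ with $G\in\mathcal{A}$, $H\in\mathcal{B}$. A class is $\chi$-bounded if there is a non-decreasing $f:\mathbb{N}\to\mathbb{N}$ with $\chi(G)\le f(\omega(G))$ for all members. A class $\mathcal{A}$ is intersectionwise $\chi$-guarding if for every $\chi$-bounded class $\mathcal{B}$ the graph-intersection of $\mathcal{A}$ and $\mathcal{B}$ is $\chi$-bounded. -}

module Defs where

open import Data.Nat using (ℕ; suc; _≤_; _<_)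
open import Data.Fin using (Fin; toℕ)
open import Data.Bool using (Bool; true; false; _∧_)
open import Data.Product using (Σ; ∃; _×_; _,_; proj₁; proj₂)
open import Data.Sum using (_⊎_)
open import Relation.Binary.PropositionalEquality using (_≡_; _≢_)
open import Function.Definitions using (Injective)
open import Relation.Nullary using (¬_)

record Graph (n : ℕ) : Set where
  field
    adj  : Fin n → Fin n → Bool
    sym  : ∀ u v → adj u v ≡ adj v u
    irr  : ∀ u → adj u u ≡ false
open Graph public

Class : Set₁
Class = (n : ℕ) → Graph n → Set

-- Closed under isomorphism and induced subgraphs: if X embeds into G as an
-- induced subgraph (injective, adjacency-preserving-and-reflecting map), and
-- G ∈ C, then X ∈ C.  (Isomorphisms are such embeddings.)
IsHereditary : Class → Set
IsHereditary C = ∀ {m n} (X : Graph m) (G : Graph n) (e : Fin m → Fin n) →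
  Injective _≡_ _≡_ e → (∀ u v → adj X u v ≡ adj G (e u) (e v)) →
  C n G → C m X

Colorable : ∀ {n} → Graph n → ℕ → Set
Colorable {n} G k = Σ (Fin n → Fin k) λ c → ∀ u v → adj G u v ≡ true → c u ≢ c v

HasClique : ∀ {n} → Graph n → ℕ → Set
HasClique {n} G k = Σ (Fin k → Fin n) λ f →
  Injective _≡_ _≡_ f × (∀ i j → i ≢ j → adj G (f i) (f j) ≡ true)

CliqueNumber : ∀ {n} → Graph n → ℕ → Set
CliqueNumber G w = HasClique G w × ¬ HasClique G (suc w)

ChiBounded : Class → Set
ChiBounded C = Σ (ℕ → ℕ) λ f → (∀ a b → a ≤ b → f a ≤ f b) ×
  (∀ n (G : Graph n) → C n G → ∀ w → CliqueNumber G w → Colorable G (f w))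

_⊓_ : Class → Class → Class
(A ⊓ B) n X = Σ (Graph n) λ G → Σ (Graph n) λ H → A n G × B n H ×
  (∀ u v → adj X u v ≡ (adj G u v ∧ adj H u v))

IntersectionwiseChiGuarding : Class → Set₁
IntersectionwiseChiGuarding A =
  (B : Class) → IsHereditary B → ChiBounded B → ChiBounded (A ⊓ B)

Bipartite : ∀ {n} → Graph n → Set
Bipartite {n} G = Σ (Fin n → Bool) λ s → ∀ u v → adj G u v ≡ true → s u ≢ s v

-- Edges of G, each unordered edge {u,v} represented once as (u , v) with u < v.
IsEdge : ∀ {n} → Graph n → Fin n × Fin n → Set
IsEdge G (u , v) = (toℕ u < toℕ v) × adj G u v ≡ true

ShareEnd : ∀ {n} → Fin n × Fin n → Fin n × Fin n → Set
ShareEnd (a , b) (c , d) = (a ≡ c ⊎ a ≡ d) ⊎ (b ≡ c ⊎ b ≡ d)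

-- X is (isomorphic to) the line graph L(G): e is a bijection from V(X) onto E(G),
-- and two distinct vertices of X are adjacent iff their edges share an endpoint.
IsLineGraphOf : ∀ {m n} → Graph m → Graph n → Set
IsLineGraphOf {m} {n} X G = Σ (Fin m → Fin n × Fin n) λ e →
  (∀ i → IsEdge G (e i)) × Injective _≡_ _≡_ e ×
  (∀ p → IsEdge G p → ∃ λ i → e i ≡ p) ×
  (∀ i j → (adj X i j ≡ true → i ≢ j × ShareEnd (e i) (e j)) ×
           (i ≢ j → ShareEnd (e i) (e j) → adj X i j ≡ true))

LineGraphsOfBipartite : Class
LineGraphsOfBipartite m X = Σ ℕ λ n → Σ (Graph n) λ G → Bipartite G × IsLineGraphOf X G

{-# OPTIONS --safe #-}
-- Let X = L(K) ∩ H with K bipartite and H ∈ B. Adjacent vertices of X are edges of K sharing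
-- an endpoint v, hence they have the same endpoint on the side of v. For a fixed side β, the
-- edges of K with a common endpoint on side β form a clique of L(K), on which X agrees with H;
-- so X restricted to such a group lies in B, has clique number at most ω(X), and is
-- f(ω(X))-colorable. Pairing the two colors a vertex receives, one per side, colors X
-- properly with f(ω(X))² colors.
module Submission where

open import Defs
open import Data.Bool using (Bool; true; false; _∧_)
open import Data.Bool.Properties using (∧-conicalˡ) renaming (_≟_ to _≟ᵇ_)
open import Data.Fin.Base using (Fin; zero; suc; toℕ; inject≤; combine; finToFun; funToFin)
open import Data.Fin.Properties
  using (any?; all?; pigeonhole; finToFun-funToFin; inject≤-injective; combine-injective; _≟_)
open import Data.List.Base using (List; _∷_; filter; allFin; length; lookup)
open import Data.List.Membership.Propositional using (_∈_)
open import Data.List.Membership.Propositional.Properties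
  using (∈-filter⁺; ∈-filter⁻; ∈-lookup; ∈-allFin)
open import Data.List.Relation.Unary.All as All using ()
open import Data.List.Relation.Unary.AllPairs using (_∷_)
import Data.List.Relation.Unary.Any as Any
open import Data.List.Relation.Unary.Any.Properties using (lookup-index)
open import Data.List.Relation.Unary.Unique.Propositional using (Unique)
open import Data.List.Relation.Unary.Unique.Propositional.Properties as Unique using (allFin⁺)
open import Data.Nat.Base using (ℕ; zero; suc; _≤_; _*_)
open import Data.Nat.Properties using (n<1+n; <-irrefl; ≰⇒>; *-mono-≤; _≤?_)
open import Data.Product using (Σ; ∃; _×_; _,_; proj₁; proj₂)
open import Data.Sum using (_⊎_; inj₁; inj₂)
open import Function.Base using (_∘_)
open import Function.Definitions using (Injective)
open import Relation.Binary.PropositionalEquality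
  using (_≡_; _≢_; refl; trans; cong; subst; subst₂; _≗_)
import Relation.Binary.PropositionalEquality as ≡
open import Relation.Nullary using (¬_; Dec; yes; no; contradiction)
open import Relation.Nullary.Decidable using (map′; _×-dec_; _→-dec_; ¬?)
open import Level using (0ℓ)
open import Relation.Unary using (Pred; Decidable)

∃-threshold : (P : ℕ → Set) → Decidable P → ∀ n → P 0 → ¬ P n → ∃ λ k → P k × ¬ P (suc k)
∃-threshold P P? zero    p₀ ¬pₙ = contradiction p₀ ¬pₙ
∃-threshold P P? (suc n) p₀ ¬pₙ₊₁ with P? n
... | yes pₙ = n , pₙ , ¬pₙ₊₁
... | no ¬pₙ = ∃-threshold P P? n p₀ ¬pₙ

module _ {n : ℕ} (G : Graph n) where

  IsClique : ∀ {k} → (Fin k → Fin n) → Set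
  IsClique f = Injective _≡_ _≡_ f × (∀ i j → i ≢ j → adj G (f i) (f j) ≡ true)

  isClique? : ∀ {k} → Decidable (IsClique {k})
  isClique? f =
    map′ (λ inj {i} {j} → inj i j) (λ inj i j → inj {i} {j})
      (all? λ i → all? λ j → (f i ≟ f j) →-dec (i ≟ j))
    ×-dec all? (λ i → all? λ j → ¬? (i ≟ j) →-dec (adj G (f i) (f j) ≟ᵇ true))

  IsClique-resp : ∀ {k} {f g : Fin k → Fin n} → f ≗ g → IsClique f → IsClique g
  IsClique-resp f≗g (inj , clique) =
    (λ {i} {j} gi≡gj → inj (trans (f≗g i) (trans gi≡gj (≡.sym (f≗g j))))) ,
    (λ i j i≢j → subst₂ (λ u v → adj G u v ≡ true) (f≗g i) (f≗g j) (clique i j i≢j))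

  hasClique? : ∀ k → Dec (HasClique G k)
  hasClique? k =
    map′ (λ (j , c) → finToFun j , c)
         (λ (f , c) → funToFin f , IsClique-resp (≡.sym ∘ finToFun-funToFin f) c)
         (any? (isClique? ∘ finToFun))

  ¬HasClique-1+n : ¬ HasClique G (suc n)
  ¬HasClique-1+n (f , inj , _) with pigeonhole (n<1+n n) f
  ... | i , j , i<j , fi≡fj = <-irrefl (cong toℕ (inj fi≡fj)) i<j

  HasClique-≤ : ∀ {j k} → j ≤ k → HasClique G k → HasClique G j
  HasClique-≤ j≤k (f , inj , clique) =
    f ∘ (λ i → inject≤ i j≤k) ,
    (λ e → inject≤-injective j≤k j≤k _ _ (inj e)) ,
    (λ i j i≢j → clique _ _ (i≢j ∘ inject≤-injective j≤k j≤k i j))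

  cliqueNumber : ∃ (CliqueNumber G)
  cliqueNumber = ∃-threshold (HasClique G) hasClique? (suc n) emptyClique ¬HasClique-1+n
    where
    emptyClique : HasClique G 0
    emptyClique = (λ ()) , (λ { {()} }) , (λ ())

  CliqueNumber-maximal : ∀ {w k} → CliqueNumber G w → HasClique G k → k ≤ w
  CliqueNumber-maximal {w} {k} (_ , ¬clique) clique with k ≤? w
  ... | yes k≤w = k≤w
  ... | no k≰w = contradiction (HasClique-≤ (≰⇒> k≰w) clique) ¬clique

induced : ∀ {m n} → Graph n → (Fin m → Fin n) → Graph m
induced G ι = record
  { adj = λ i j → adj G (ι i) (ι j)
  ; sym = λ i j → sym G (ι i) (ι j)
  ; irr = λ i → irr G (ι i)
  }

module _ {m n} (G : Graph n) {ι : Fin m → Fin n} (ι-injective : Injective _≡_ _≡_ ι) where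

  HasClique-induced : ∀ {k} → HasClique (induced G ι) k → HasClique G k
  HasClique-induced (f , inj , clique) = ι ∘ f , inj ∘ ι-injective , clique

  CliqueNumber-induced-≤ : ∀ {w′ w} → CliqueNumber (induced G ι) w′ → CliqueNumber G w → w′ ≤ w
  CliqueNumber-induced-≤ (clique , _) ω≡w = CliqueNumber-maximal G ω≡w (HasClique-induced clique)

Colorable-≤ : ∀ {n} {G : Graph n} {k l} → k ≤ l → Colorable G k → Colorable G l
Colorable-≤ k≤l (c , proper) =
  (λ u → inject≤ (c u) k≤l) ,
  (λ u v uv → proper u v uv ∘ inject≤-injective k≤l k≤l (c u) (c v))

lookup-injective : ∀ {A : Set} {xs : List A} → Unique xs → Injective _≡_ _≡_ (lookup xs)
lookup-injective {xs = _ ∷ _} (_  ∷ _) {zero}  {zero}  _  = refl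
lookup-injective {xs = _ ∷ _} (x∉ ∷ _) {zero}  {suc j} eq = contradiction eq (All.lookup x∉ (∈-lookup j))
lookup-injective {xs = _ ∷ _} (x∉ ∷ _) {suc i} {zero}  eq = contradiction (≡.sym eq) (All.lookup x∉ (∈-lookup i))
lookup-injective {xs = _ ∷ _} (_  ∷ u) {suc i} {suc j} eq = cong suc (lookup-injective u eq)

record Enumeration {n} (P : Pred (Fin n) 0ℓ) : Set where
  field
    size           : ℕ
    elem           : Fin size → Fin n
    elem-injective : Injective _≡_ _≡_ elem
    elem-satisfies : ∀ i → P (elem i)
    index          : ∀ {x} → P x → Fin size
    elem-index     : ∀ {x} (px : P x) → elem (index px) ≡ x

enumerate : ∀ {n} {P : Pred (Fin n) 0ℓ} → Decidable P → Enumeration P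
enumerate {n} {P} P? = record
  { size           = length xs
  ; elem           = lookup xs
  ; elem-injective = lookup-injective (Unique.filter⁺ P? (allFin⁺ n))
  ; elem-satisfies = λ i → proj₂ (∈-filter⁻ P? {xs = allFin n} (∈-lookup i))
  ; index          = λ px → Any.index (x∈xs px)
  ; elem-index     = λ px → ≡.sym (lookup-index (x∈xs px))
  }
  where
  xs : List (Fin n)
  xs = filter P? (allFin n)
  x∈xs : ∀ {x} → P x → x ∈ xs
  x∈xs {x} px = ∈-filter⁺ P? (∈-allFin x) px

module _ {n N} (X : Graph n) (π : Fin n → Fin N) where

  fiber : (v : Fin N) → Enumeration (λ x → π x ≡ v)
  fiber v = enumerate (λ x → π x ≟ v)

  open Enumeration

  color-by-fibers : ∀ {k} → (∀ v → Colorable (induced X (elem (fiber v))) k) →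
    Σ (Fin n → Fin k) λ c → ∀ x y → adj X x y ≡ true → π x ≡ π y → c x ≢ c y
  color-by-fibers {k} color = c , proper
    where
    c : Fin n → Fin k
    c x = proj₁ (color (π x)) (index (fiber (π x)) refl)

    c-at : ∀ {v} x (πx≡v : π x ≡ v) → c x ≡ proj₁ (color v) (index (fiber v) πx≡v)
    c-at x refl = refl

    proper : ∀ x y → adj X x y ≡ true → π x ≡ π y → c x ≢ c y
    proper x y xy πx≡πy cx≡cy =
      proj₂ (color (π x)) i j ij (trans cx≡cy (c-at y (≡.sym πx≡πy)))
      where
      i j : Fin (size (fiber (π x)))
      i = index (fiber (π x)) refl
      j = index (fiber (π x)) (≡.sym πx≡πy)
      ij : adj X (elem (fiber (π x)) i) (elem (fiber (π x)) j) ≡ true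
      ij rewrite elem-index (fiber (π x)) {x} refl | elem-index (fiber (π x)) {y} (≡.sym πx≡πy) = xy

Colorable-product : ∀ {n k} (X : Graph n) (c : Bool → Fin n → Fin k) →
  (∀ x y → adj X x y ≡ true → ∃ λ β → c β x ≢ c β y) → Colorable X (k * k)
Colorable-product {n} {k} X c separated = color , proper
  where
  color : Fin n → Fin (k * k)
  color x = combine (c true x) (c false x)

  proper : ∀ x y → adj X x y ≡ true → color x ≢ color y
  proper x y xy eq with separated x y xy | combine-injective _ _ _ _ eq
  ... | true  , c≢ | c≡ , _ = c≢ c≡
  ... | false , c≢ | _ , c≡ = c≢ c≡

module _ {N : ℕ} where

  Endpoint : Fin N → Fin N × Fin N → Set
  Endpoint v (a , b) = a ≡ v ⊎ b ≡ v

  ShareEnd-intro : ∀ {v p q} → Endpoint v p → Endpoint v q → ShareEnd p q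
  ShareEnd-intro (inj₁ a≡v) (inj₁ c≡v) = inj₁ (inj₁ (trans a≡v (≡.sym c≡v)))
  ShareEnd-intro (inj₁ a≡v) (inj₂ d≡v) = inj₁ (inj₂ (trans a≡v (≡.sym d≡v)))
  ShareEnd-intro (inj₂ b≡v) (inj₁ c≡v) = inj₂ (inj₁ (trans b≡v (≡.sym c≡v)))
  ShareEnd-intro (inj₂ b≡v) (inj₂ d≡v) = inj₂ (inj₂ (trans b≡v (≡.sym d≡v)))

  ShareEnd-elim : ∀ {p q} → ShareEnd p q → ∃ λ v → Endpoint v p × Endpoint v q
  ShareEnd-elim (inj₁ (inj₁ a≡c)) = _ , inj₁ refl , inj₁ (≡.sym a≡c)
  ShareEnd-elim (inj₁ (inj₂ a≡d)) = _ , inj₁ refl , inj₂ (≡.sym a≡d)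
  ShareEnd-elim (inj₂ (inj₁ b≡c)) = _ , inj₂ refl , inj₁ (≡.sym b≡c)
  ShareEnd-elim (inj₂ (inj₂ b≡d)) = _ , inj₂ refl , inj₂ (≡.sym b≡d)

  module _ (side : Fin N → Bool) where

    end : Bool → Fin N × Fin N → Fin N
    end β (a , b) with side a ≟ᵇ β
    ... | yes _ = a
    ... | no  _ = b

    end-Endpoint : ∀ β p → Endpoint (end β p) p
    end-Endpoint β (a , b) with side a ≟ᵇ β
    ... | yes _ = inj₁ refl
    ... | no  _ = inj₂ refl

    end-side : ∀ {a b v} → side a ≢ side b → Endpoint v (a , b) → end (side v) (a , b) ≡ v
    end-side {a} {b} _ (inj₁ refl) with side a ≟ᵇ side a
    ... | yes _     = refl
    ... | no  sa≢sa = contradiction refl sa≢sa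
    end-side {a} {b} sa≢sb (inj₂ refl) with side a ≟ᵇ side b
    ... | yes sa≡sb = contradiction sa≡sb sa≢sb
    ... | no  _     = refl

module _ {B : Class} {f : ℕ → ℕ} (f-mono : ∀ a b → a ≤ b → f a ≤ f b)
  (f-bounds : ∀ n (G : Graph n) → B n G → ∀ w → CliqueNumber G w → Colorable G (f w)) where

  Colorable-induced : ∀ {m n w} (X : Graph n) {ι : Fin m → Fin n} → Injective _≡_ _≡_ ι →
    B m (induced X ι) → CliqueNumber X w → Colorable (induced X ι) (f w)
  Colorable-induced X {ι} ι-injective X[ι]∈B ω≡w with cliqueNumber (induced X ι)
  ... | w′ , ω′≡w′ =
    Colorable-≤ {G = induced X ι} (f-mono _ _ (CliqueNumber-induced-≤ X ι-injective ω′≡w′ ω≡w))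
                                  (f-bounds _ _ X[ι]∈B w′ ω′≡w′)

  module _ (B-hereditary : IsHereditary B) {n N} (X G H : Graph n) (K : Graph N)
    (side : Fin N → Bool) (bipartite : ∀ u v → adj K u v ≡ true → side u ≢ side v)
    (e : Fin n → Fin N × Fin N) (e-edge : ∀ x → IsEdge K (e x))
    (G-adj : ∀ x y → (adj G x y ≡ true → x ≢ y × ShareEnd (e x) (e y)) ×
                     (x ≢ y → ShareEnd (e x) (e y) → adj G x y ≡ true))
    (H∈B : B n H) (X-adj : ∀ x y → adj X x y ≡ (adj G x y ∧ adj H x y))
    {w : ℕ} (ω≡w : CliqueNumber X w) where

    open Enumeration

    π : Bool → Fin n → Fin N
    π β x = end side β (e x)

    fiber-clique : ∀ β {x y} → π β x ≡ π β y → x ≢ y → adj G x y ≡ true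
    fiber-clique β {x} {y} πx≡πy x≢y = proj₂ (G-adj x y) x≢y
      (ShareEnd-intro (subst (λ v → Endpoint v (e x)) πx≡πy (end-Endpoint side β (e x)))
                      (end-Endpoint side β (e y)))

    adj-X≡adj-H : ∀ x y → (x ≢ y → adj G x y ≡ true) → adj X x y ≡ adj H x y
    adj-X≡adj-H x y clique with x ≟ y
    ... | yes refl = trans (irr X x) (≡.sym (irr H x))
    ... | no  x≢y rewrite X-adj x y | clique x≢y = refl

    fiber∈B : ∀ β v → B _ (induced X (elem (fiber X (π β) v)))
    fiber∈B β v = B-hereditary _ H (elem F) (elem-injective F)
      (λ i j → adj-X≡adj-H (elem F i) (elem F j)
                 (fiber-clique β (trans (elem-satisfies F i) (≡.sym (elem-satisfies F j)))))
      H∈B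
      where
      F : Enumeration (λ x → π β x ≡ v)
      F = fiber X (π β) v

    color-side : ∀ β → Σ (Fin n → Fin (f w)) λ c →
      ∀ x y → adj X x y ≡ true → π β x ≡ π β y → c x ≢ c y
    color-side β = color-by-fibers X (π β) λ v →
      Colorable-induced X (elem-injective (fiber X (π β) v)) (fiber∈B β v) ω≡w

    X⊆G : ∀ x y → adj X x y ≡ true → adj G x y ≡ true
    X⊆G x y xy = ∧-conicalˡ _ _ (trans (≡.sym (X-adj x y)) xy)

    shared-side : ∀ x y → adj X x y ≡ true → ∃ λ β → π β x ≡ π β y
    shared-side x y xy with ShareEnd-elim (proj₂ (proj₁ (G-adj x y) (X⊆G x y xy)))
    ... | v , v∈x , v∈y = side v ,
      trans (end-side side (bipartite _ _ (proj₂ (e-edge x))) v∈x)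
            (≡.sym (end-side side (bipartite _ _ (proj₂ (e-edge y))) v∈y))

    Colorable-lineGraph∩ : Colorable X (f w * f w)
    Colorable-lineGraph∩ = Colorable-product X (λ β → proj₁ (color-side β)) λ x y xy →
      let (β , πx≡πy) = shared-side x y xy in β , proj₂ (color-side β) x y xy πx≡πy

corollary3p13 : IntersectionwiseChiGuarding LineGraphsOfBipartite
corollary3p13 B B-hereditary (f , f-mono , f-bounds) =
  (λ w → f w * f w) ,
  (λ a b a≤b → *-mono-≤ (f-mono a b a≤b) (f-mono a b a≤b)) ,
  λ { n X (G , H , (N , K , (side , bipartite) , (e , e-edge , _ , _ , G-adj)) , H∈B , X-adj) w ω≡w →
      Colorable-lineGraph∩ f-mono f-bounds B-hereditary X G H K side bipartite e e-edge G-adj H∈B X-adj ω≡w }
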